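{- Let $\mathcal M$ and $\mathcal N$ be connected minions. If there is a minion homomorphism $\mathcal M\times\mathcal N\to\mathcal P$, then there is a minion homomorphism $\mathcal M\to\mathcal P$ or a minion homomorphism $\mathcal N\to\mathcal P$.
   Context: Write $n=\{0,\dots,n-1\}$. A minion consists of sets $\mathcal M_k$ ($k\ge1$) and maps $f\mapsto f\alpha$ for each map $\alpha:k\to m$, with $f\,\mathrm{id}=f$, $(f\alpha)\beta=f(\beta\circ\alpha)$; homomorphisms are arity-wise maps commuting with these. The product $\mathcal M\times\mathcal N$ has arity-$k$ set $\mathcal M_k\times\mathcal N_k$ with componentwise action. The projection minion $\mathcal P$ has $\mathcal P_k=k$ and $i\alpha=\alpha(i)$. A minion is connected if it has exactly one element of arity 1. -}

module Defs where

open import Data.Nat using (ℕ; suc)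
open import Data.Fin using (Fin)
open import Data.Product using (_×_; _,_; proj₁; proj₂; Σ)
open import Relation.Binary.PropositionalEquality using (_≡_; cong₂)
open import Function using (_∘_; id)

-- Convention: the arity-indexed set at index n : ℕ is the set of
-- elements of arity (suc n), i.e. arities k ≥ 1; Fin (suc n) = {0,…,n}.
record Minion : Set₁ where
  field
    El    : ℕ → Set
    act   : ∀ {k m} → El k → (Fin (suc k) → Fin (suc m)) → El m
    act-id   : ∀ {k} (f : El k) → act f id ≡ f
    act-comp : ∀ {k m l} (f : El k) (α : Fin (suc k) → Fin (suc m))
                 (β : Fin (suc m) → Fin (suc l)) →
               act (act f α) β ≡ act f (β ∘ α)
    -- the action depends only on the map α (automatic set-theoretically;
    -- needed since Agda lacks function extensionality)
    act-cong : ∀ {k m} (f : El k) {α β : Fin (suc k) → Fin (suc m)} →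
               (∀ i → α i ≡ β i) → act f α ≡ act f β

open Minion public

record Hom (M N : Minion) : Set where
  field
    map  : ∀ {k} → El M k → El N k
    comm : ∀ {k m} (f : El M k) (α : Fin (suc k) → Fin (suc m)) →
           map (act M f α) ≡ act N (map f) α

open Hom public

_⊗_ : Minion → Minion → Minion
M ⊗ N = record
  { El = λ k → El M k × El N k
  ; act = λ p α → act M (proj₁ p) α , act N (proj₂ p) α
  ; act-id = λ p → cong₂ _,_ (act-id M (proj₁ p)) (act-id N (proj₂ p))
  ; act-comp = λ p α β → cong₂ _,_ (act-comp M (proj₁ p) α β) (act-comp N (proj₂ p) α β)
  ; act-cong = λ p e → cong₂ _,_ (act-cong M (proj₁ p) e) (act-cong N (proj₂ p) e)
  }

Proj : Minion
Proj = record
  { El = λ k → Fin (suc k)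
  ; act = λ i α → α i
  ; act-id = λ i → _≡_.refl
  ; act-comp = λ i α β → _≡_.refl
  ; act-cong = λ i e → e i
  }

Connected : Minion → Set
Connected M = Σ (El M 0) (λ c → ∀ x → x ≡ c)

{-# OPTIONS --safe #-}
module Submission where

-- Let c and d be the unary elements of M and N, and let h : M × N → P.
-- The binary element (c(x₀), d(x₁)) is sent by h to 0 or 1; by swapping
-- the factors we may assume it is 0, i.e. h follows the M-coordinate.
-- Then f ↦ h(f(x₁,x₂,…), d(x₀)) never picks the dummy coordinate x₀:
-- the minor x₀ ↦ x₁, xᵢ₊₁ ↦ x₀ sends x₀ to x₁, but sends the argument to
-- (c(x₀), d(x₁)) since M is connected, and h maps that to x₀.
-- Dropping x₀ gives a homomorphism M → P.

open import Data.Fin using (Fin; zero; suc; lift; opposite; punchOut)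
open import Data.Fin.Properties using (0≢1+n)
open import Data.Nat using (ℕ; suc)
open import Data.Product using (_,_; proj₁)
open import Data.Sum using (_⊎_; inj₁; inj₂)
open import Function using (_∘_)
open import Relation.Binary.PropositionalEquality
open import Relation.Nullary using (contradiction)

open import Defs

private variable
  k m : ℕ

infixr 9 _∘ₕ_
_∘ₕ_ : {L M N : Minion} → Hom M N → Hom L M → Hom L N
map (g ∘ₕ f) = map g ∘ map f
comm (g ∘ₕ f) x α = trans (cong (map g) (comm f x α)) (comm g (map f x) α)

⊗-swap : {M N : Minion} → Hom (N ⊗ M) (M ⊗ N)
map ⊗-swap (y , x) = x , y
comm ⊗-swap _ _ = refl

constAt : (M : Minion) → El M 0 → Fin (suc m) → El M m
constAt M c z = act M c (λ _ → z)

connected-act-const : (M : Minion) ((c , _) : Connected M) (f : El M k)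
                      (z : Fin (suc m)) → act M f (λ _ → z) ≡ constAt M c z
connected-act-const M (c , unique) f z = begin
  act M f (λ _ → z)                      ≡⟨ act-comp M f (λ _ → zero) (λ _ → z) ⟨
  act M (act M f (λ _ → zero)) (λ _ → z) ≡⟨ cong (λ g → act M g (λ _ → z)) (unique _) ⟩
  act M c (λ _ → z)                      ∎
  where open ≡-Reasoning

punchOut-zero-lift : (α : Fin (suc k) → Fin (suc m)) {i : Fin (suc (suc k))}
                     {j : Fin (suc (suc m))} (0≢i : zero ≢ i) (0≢j : zero ≢ j) →
                     j ≡ lift 1 α i → punchOut 0≢j ≡ α (punchOut 0≢i)
punchOut-zero-lift α {zero}  0≢i _ _    = contradiction refl 0≢i
punchOut-zero-lift α {suc i} _   _ refl = refl

choice : (M N : Minion) → El M 0 → El N 0 → Hom (M ⊗ N) Proj → Fin 2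
choice M N c d h = map h (constAt M c zero , constAt N d (suc zero))

choice-⊗-swap : (M N : Minion) (c : El M 0) (d : El N 0) (h : Hom (M ⊗ N) Proj) →
                choice N M d c (h ∘ₕ ⊗-swap) ≡ opposite (choice M N c d h)
choice-⊗-swap M N c d h = begin
  map h (constAt M c (suc zero) , constAt N d zero)
    ≡⟨ cong (map h) (cong₂ _,_ (act-comp M c _ opposite) (act-comp N d _ opposite)) ⟨
  map h (act (M ⊗ N) (constAt M c zero , constAt N d (suc zero)) opposite)
    ≡⟨ comm h _ opposite ⟩
  opposite (choice M N c d h) ∎
  where open ≡-Reasoning

module FollowLeft (M N : Minion) (connM : Connected M) (d : El N 0) (h : Hom (M ⊗ N) Proj)
                  (h-follows-M : choice M N (proj₁ connM) d h ≡ zero) where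

  probe : El M k → Fin (suc (suc k))
  probe f = map h (act M f suc , constAt N d zero)

  collapse : Fin (suc (suc k)) → Fin 2
  collapse zero    = suc zero
  collapse (suc _) = zero

  collapse-probe : (f : El M k) → collapse (probe f) ≡ choice M N (proj₁ connM) d h
  collapse-probe f = begin
    collapse (probe f)
      ≡⟨ comm h _ collapse ⟨
    map h (act M (act M f suc) collapse , act N (constAt N d zero) collapse)
      ≡⟨ cong (map h) (cong₂ _,_ (trans (act-comp M f suc collapse)
                                        (connected-act-const M connM f zero))
                                 (act-comp N d _ collapse)) ⟩
    choice M N (proj₁ connM) d h ∎
    where open ≡-Reasoning

  probe-avoids-zero : (f : El M k) → zero ≢ probe f
  probe-avoids-zero f 0≡probe =
    0≢1+n (sym (trans (cong collapse 0≡probe) (trans (collapse-probe f) h-follows-M)))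

  probe-natural : (f : El M k) (α : Fin (suc k) → Fin (suc m)) →
                  probe (act M f α) ≡ lift 1 α (probe f)
  probe-natural f α = begin
    map h (act M (act M f α) suc , constAt N d zero)
      ≡⟨ cong (map h) (cong₂ _,_ shift-natural (act-comp N d _ (lift 1 α))) ⟨
    map h (act M (act M f suc) (lift 1 α) , act N (constAt N d zero) (lift 1 α))
      ≡⟨ comm h _ (lift 1 α) ⟩
    lift 1 α (probe f) ∎
    where
    open ≡-Reasoning
    shift-natural : act M (act M f suc) (lift 1 α) ≡ act M (act M f α) suc
    shift-natural = trans (act-comp M f suc (lift 1 α)) (sym (act-comp M f α suc))

  hom : Hom M Proj
  map hom f = punchOut (probe-avoids-zero f)
  comm hom f α =
    punchOut-zero-lift α (probe-avoids-zero f) (probe-avoids-zero (act M f α))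
      (probe-natural f α)

lemma7p7p4 : (M N : Minion) → Connected M → Connected N →
    Hom (M ⊗ N) Proj → Hom M Proj ⊎ Hom N Proj
lemma7p7p4 M N connM@(c , _) connN@(d , _) h with choice M N c d h in eq
... | zero     = inj₁ (FollowLeft.hom M N connM d h eq)
... | suc zero = inj₂ (FollowLeft.hom N M connN c (h ∘ₕ ⊗-swap)
                         (trans (choice-⊗-swap M N c d h) (cong opposite eq)))
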